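{- For every positive integer $k$, $$\sum_{n=0}^{k-1}(-2)^n(n-k+1)\binom{ -k}{n}=(-1)^{k+1}(3k-1)-(-2)^k\sum_{n=0}^{k-1}(2n-2k+1)\binom{ -k}{n}.$$
   Context: For an integer $m$ and nonnegative integer $n$, $\binom{m}{n}=\frac{m(m-1)\cdots(m-n+1)}{n!}$ (generalized binomial coefficient); in particular $\binom{ -k}{n}=(-1)^n\binom{n+k-1}{n}$. -}

module Defs where

open import Data.Nat as ℕ using (ℕ; zero; suc; _!)
open import Data.Nat.Properties using (_!≢0)
open import Data.Integer using (ℤ; +_; _-_; _*_; _+_; -_; _^_)
open import Data.Integer.DivMod using (_/ℕ_)
open import Data.List using (List; upTo; map; foldr)

falling : ℤ → ℕ → ℤ
falling m zero    = + 1
falling m (suc n) = falling m n * (m - + n)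

-- generalized binomial coefficient: m(m-1)...(m-n+1) / n!
-- (the division is exact)
binom : ℤ → ℕ → ℤ
binom m n = _/ℕ_ (falling m n) (n !) {{n !≢0}}

sumTo : ℕ → (ℕ → ℤ) → ℤ
sumTo k f = foldr _+_ (+ 0) (map f (upTo k))

private
  open import Relation.Binary.PropositionalEquality using (_≡_; refl)
  t1 : binom (- + 3) 2 ≡ + 6
  t1 = refl
  t2 : binom (- + 2) 3 ≡ - + 4
  t2 = refl

-- With k = 1 + j we have binom(-k, n) = (-1)ⁿ C(j+n, n), so both sides are values at x = 2 and
-- x = -1 of the truncations σⱼ(x) = Σ_{n≤j} C(j+n,n) xⁿ and θσⱼ(x) = Σ_{n≤j} n C(j+n,n) xⁿ of
-- the series of (1 - x)^(-k) and of its Euler derivative. Pascal's rule gives the recurrence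
-- (1 - x) σⱼ₊₁(x) = σⱼ(x) + C(2j+1, j+1) xᵏ (1 - 2x), and one for θσ, from which induction on j
-- proves, for x + y = 1, the symmetry yᵏ σⱼ(x) + xᵏ σⱼ(y) = 1 and its derivative
-- yᵏ⁺¹ θσⱼ(x) - xᵏ⁺¹ θσⱼ(y) = k x y (yʲ σⱼ(x) - xʲ σⱼ(y)). At (x, y) = (2, -1) these two
-- identities determine the theorem.
module Submission where

open import Defs
open import Data.Nat using (ℕ; _≤_)
open import Data.Integer using (ℤ; +_; -_; _-_; _+_; _*_; _^_)
open import Relation.Binary.PropositionalEquality using (_≡_)

import Data.Nat as ℕ
open import Data.Nat using (zero; suc; _!)
import Data.Nat.Properties as ℕₚ
open import Data.Nat.Properties using (_!≢0; _!*_!≢0)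
open import Data.Nat.DivMod using (m*n/n≡m; m*n%n≡0; m/n*n≡m)
open import Data.Nat.Combinatorics
  using (_C_; nCk≡n!/k![n-k]!; k![n∸k]!∣n!; nCk≡nC[n∸k]; nCk+nC[k+1]≡[n+1]C[k+1])
open import Data.Integer using (-[1+_])
open import Data.Integer.DivMod using (_/ℕ_)
import Data.Integer.Properties as ℤₚ
open import Data.Integer.Properties using (pos-+; pos-*)
open import Data.Integer.Tactic.RingSolver using (solve-∀)
open import Algebra.Properties.AbelianGroup ℤₚ.+-0-abelianGroup using (x∙y⁻¹≈ε⇒x≈y; x≈y⇒x∙y⁻¹≈ε)
open import Data.List using (foldr; upTo)
open import Data.List.Properties using (map-applyUpTo; map-upTo; map-cong)
open import Function using (_∘_)
open import Relation.Binary.PropositionalEquality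
  using (refl; sym; trans; cong; cong₂; module ≡-Reasoning)

open ≡-Reasoning

sumTo-sucˡ : ∀ m (f : ℕ → ℤ) → sumTo (suc m) f ≡ f 0 + sumTo m (f ∘ suc)
sumTo-sucˡ m f = cong (λ xs → f 0 + foldr _+_ (+ 0) xs)
  (trans (map-applyUpTo suc f m) (sym (map-upTo (f ∘ suc) m)))

sumTo-sucʳ : ∀ m (f : ℕ → ℤ) → sumTo (suc m) f ≡ sumTo m f + f m
sumTo-sucʳ zero    f = trans (ℤₚ.+-identityʳ (f 0)) (sym (ℤₚ.+-identityˡ (f 0)))
sumTo-sucʳ (suc m) f = begin
  sumTo (suc (suc m)) f                  ≡⟨ sumTo-sucˡ (suc m) f ⟩
  f 0 + sumTo (suc m) (f ∘ suc)          ≡⟨ cong (_+_ (f 0)) (sumTo-sucʳ m (f ∘ suc)) ⟩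
  f 0 + (sumTo m (f ∘ suc) + f (suc m))  ≡⟨ ℤₚ.+-assoc (f 0) (sumTo m (f ∘ suc)) (f (suc m)) ⟨
  f 0 + sumTo m (f ∘ suc) + f (suc m)    ≡⟨ cong (_+ f (suc m)) (sumTo-sucˡ m f) ⟨
  sumTo (suc m) f + f (suc m)            ∎

sumTo-cong : ∀ m {f g : ℕ → ℤ} → (∀ n → f n ≡ g n) → sumTo m f ≡ sumTo m g
sumTo-cong m f≗g = cong (foldr _+_ (+ 0)) (map-cong f≗g (upTo m))

sumTo-distrib-+ : ∀ m (f g : ℕ → ℤ) → sumTo m (λ n → f n + g n) ≡ sumTo m f + sumTo m g
sumTo-distrib-+ zero    f g = refl
sumTo-distrib-+ (suc m) f g = begin
  sumTo (suc m) (λ n → f n + g n)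
    ≡⟨ sumTo-sucˡ m (λ n → f n + g n) ⟩
  f 0 + g 0 + sumTo m (λ n → f (suc n) + g (suc n))
    ≡⟨ cong (_+_ (f 0 + g 0)) (sumTo-distrib-+ m (f ∘ suc) (g ∘ suc)) ⟩
  f 0 + g 0 + (sumTo m (f ∘ suc) + sumTo m (g ∘ suc))
    ≡⟨ interchange (f 0) (g 0) (sumTo m (f ∘ suc)) (sumTo m (g ∘ suc)) ⟩
  f 0 + sumTo m (f ∘ suc) + (g 0 + sumTo m (g ∘ suc))
    ≡⟨ cong₂ _+_ (sumTo-sucˡ m f) (sumTo-sucˡ m g) ⟨
  sumTo (suc m) f + sumTo (suc m) g ∎
  where
  interchange : ∀ a b c d → a + b + (c + d) ≡ a + c + (b + d)
  interchange = solve-∀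

*-distribˡ-sumTo : ∀ m a (f : ℕ → ℤ) → a * sumTo m f ≡ sumTo m (λ n → a * f n)
*-distribˡ-sumTo zero    a f = ℤₚ.*-zeroʳ a
*-distribˡ-sumTo (suc m) a f = begin
  a * sumTo (suc m) f                      ≡⟨ cong (a *_) (sumTo-sucˡ m f) ⟩
  a * (f 0 + sumTo m (f ∘ suc))            ≡⟨ ℤₚ.*-distribˡ-+ a (f 0) (sumTo m (f ∘ suc)) ⟩
  a * f 0 + a * sumTo m (f ∘ suc)          ≡⟨ cong (_+_ (a * f 0)) (*-distribˡ-sumTo m a (f ∘ suc)) ⟩
  a * f 0 + sumTo m (λ n → a * f (suc n))  ≡⟨ sumTo-sucˡ m (λ n → a * f n) ⟨
  sumTo (suc m) (λ n → a * f n)            ∎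

nCk*k![n∸k]!≡n! : ∀ {n k} → k ≤ n → (n C k) ℕ.* (k ! ℕ.* (n ℕ.∸ k) !) ≡ n !
nCk*k![n∸k]!≡n! {n} {k} k≤n =
  trans (cong (ℕ._* (k ! ℕ.* (n ℕ.∸ k) !)) (nCk≡n!/k![n-k]! k≤n)) (m/n*n≡m (k![n∸k]!∣n! k≤n))
  where instance _ = k !* (n ℕ.∸ k) !≢0

C-pascal : ∀ j n → (suc j ℕ.+ suc n) C suc n ≡ (j ℕ.+ suc n) C suc n ℕ.+ (suc j ℕ.+ n) C n
C-pascal j n = begin
  suc (j ℕ.+ suc n) C suc n                    ≡⟨ nCk+nC[k+1]≡[n+1]C[k+1] (j ℕ.+ suc n) n ⟨
  (j ℕ.+ suc n) C n ℕ.+ c                      ≡⟨ cong (λ m → m C n ℕ.+ c) (ℕₚ.+-suc j n) ⟩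
  (suc j ℕ.+ n) C n ℕ.+ c                      ≡⟨ ℕₚ.+-comm ((suc j ℕ.+ n) C n) c ⟩
  c ℕ.+ (suc j ℕ.+ n) C n                      ∎
  where c = (j ℕ.+ suc n) C suc n

C-central : ∀ j → (suc j ℕ.+ suc j) C suc j ≡ 2 ℕ.* ((j ℕ.+ suc j) C suc j)
C-central j = begin
  (suc j ℕ.+ suc j) C suc j           ≡⟨ C-pascal j j ⟩
  c ℕ.+ (suc j ℕ.+ j) C j             ≡⟨ cong (c ℕ.+_) symmetric ⟩
  c ℕ.+ c                             ≡⟨ cong (λ m → c ℕ.+ m) (ℕₚ.+-identityʳ c) ⟨
  2 ℕ.* c                             ∎
  where
  c = (j ℕ.+ suc j) C suc j
  symmetric : (suc j ℕ.+ j) C j ≡ c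
  symmetric = begin
    (suc j ℕ.+ j) C j                      ≡⟨ nCk≡nC[n∸k] (ℕₚ.m≤n+m j (suc j)) ⟩
    (suc j ℕ.+ j) C (suc j ℕ.+ j ℕ.∸ j)    ≡⟨ cong ((suc j ℕ.+ j) C_) (ℕₚ.m+n∸n≡m (suc j) j) ⟩
    (suc j ℕ.+ j) C suc j                  ≡⟨ cong (_C suc j) (sym (ℕₚ.+-suc j j)) ⟩
    c                                      ∎

falling-neg-*-! : ∀ j n → falling (- + suc j) n * + (j !) ≡ (- + 1) ^ n * + ((j ℕ.+ n) !)
falling-neg-*-! j zero    = cong (λ m → + 1 * + (m !)) (sym (ℕₚ.+-identityʳ j))
falling-neg-*-! j (suc n) = begin
  falling (- + suc j) n * (- + suc j - + n) * + (j !)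
    ≡⟨ regroup (falling (- + suc j) n) (+ suc j) (+ n) (+ (j !)) ⟩
  - + 1 * (falling (- + suc j) n * + (j !)) * (+ suc j + + n)
    ≡⟨ cong₂ (λ a b → - + 1 * a * b) (falling-neg-*-! j n) (sym (pos-+ (suc j) n)) ⟩
  - + 1 * ((- + 1) ^ n * + ((j ℕ.+ n) !)) * + suc (j ℕ.+ n)
    ≡⟨ regroup′ ((- + 1) ^ n) (+ ((j ℕ.+ n) !)) (+ suc (j ℕ.+ n)) ⟩
  (- + 1) ^ suc n * (+ suc (j ℕ.+ n) * + ((j ℕ.+ n) !))
    ≡⟨ cong ((- + 1) ^ suc n *_) (sym (pos-* (suc (j ℕ.+ n)) ((j ℕ.+ n) !))) ⟩
  (- + 1) ^ suc n * + (suc (j ℕ.+ n) !)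
    ≡⟨ cong (λ m → (- + 1) ^ suc n * + (m !)) (sym (ℕₚ.+-suc j n)) ⟩
  (- + 1) ^ suc n * + ((j ℕ.+ suc n) !) ∎
  where
  regroup : ∀ f s b J → f * (- s - b) * J ≡ - + 1 * (f * J) * (s + b)
  regroup = solve-∀
  regroup′ : ∀ e F s → - + 1 * (e * F) * s ≡ - + 1 * e * (s * F)
  regroup′ = solve-∀

falling-neg : ∀ j n → falling (- + suc j) n ≡ (- + 1) ^ n * + ((j ℕ.+ n) C n) * + (n !)
falling-neg j n = ℤₚ.*-cancelʳ-≡ _ _ (+ (j !)) (begin
  falling (- + suc j) n * + (j !)              ≡⟨ falling-neg-*-! j n ⟩
  (- + 1) ^ n * + ((j ℕ.+ n) !)                ≡⟨ cong (λ m → (- + 1) ^ n * + m) factorials ⟨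
  (- + 1) ^ n * + (c ℕ.* (n ! ℕ.* j !))
    ≡⟨ cong ((- + 1) ^ n *_) (trans (pos-* c _) (cong (+ c *_) (pos-* (n !) (j !)))) ⟩
  (- + 1) ^ n * (+ c * (+ (n !) * + (j !)))    ≡⟨ regroup ((- + 1) ^ n) (+ c) (+ (n !)) (+ (j !)) ⟩
  (- + 1) ^ n * + c * + (n !) * + (j !)        ∎)
  where
  instance _ = j !≢0
  c = (j ℕ.+ n) C n
  factorials : c ℕ.* (n ! ℕ.* j !) ≡ (j ℕ.+ n) !
  factorials = trans (cong (λ m → c ℕ.* (n ! ℕ.* m !)) (sym (ℕₚ.m+n∸n≡m j n)))
                     (nCk*k![n∸k]!≡n! (ℕₚ.m≤n+m n j))
  regroup : ∀ e c a b → e * (c * (a * b)) ≡ e * c * a * b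
  regroup = solve-∀

-n/ℕd≡-[n/d] : ∀ n d .{{_ : ℕ.NonZero d}} → n ℕ.% d ≡ 0 → (- + n) /ℕ d ≡ - + (n ℕ./ d)
-n/ℕd≡-[n/d] zero    (suc d) _  = refl
-n/ℕd≡-[n/d] (suc n) d       eq with suc n ℕ.% d | eq
... | .0 | refl = refl

i*n/ℕn≡i : ∀ i n .{{_ : ℕ.NonZero n}} → (i * + n) /ℕ n ≡ i
i*n/ℕn≡i (+ m)     n = trans (cong (_/ℕ n) (sym (pos-* m n))) (cong +_ (m*n/n≡m m n))
i*n/ℕn≡i -[1+ m ]  n = begin
  (-[1+ m ] * + n) /ℕ n
    ≡⟨ cong (_/ℕ n) (trans (cong -_ (pos-* (suc m) n)) (ℤₚ.neg-distribˡ-* (+ suc m) (+ n))) ⟨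
  (- + (suc m ℕ.* n)) /ℕ n     ≡⟨ -n/ℕd≡-[n/d] (suc m ℕ.* n) n (m*n%n≡0 (suc m) n) ⟩
  - + (suc m ℕ.* n ℕ./ n)      ≡⟨ cong (λ q → - + q) (m*n/n≡m (suc m) n) ⟩
  -[1+ m ]                     ∎

binom-neg : ∀ j n → binom (- + suc j) n ≡ (- + 1) ^ n * + ((j ℕ.+ n) C n)
binom-neg j n =
  trans (cong (λ a → (a /ℕ n !) {{n !≢0}}) (falling-neg j n)) (i*n/ℕn≡i _ (n !) {{n !≢0}})

^-distrib-* : ∀ a b n → (a * b) ^ n ≡ a ^ n * b ^ n
^-distrib-* a b zero    = refl
^-distrib-* a b (suc n) = trans (cong (a * b *_) (^-distrib-* a b n)) (regroup a b (a ^ n) (b ^ n))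
  where
  regroup : ∀ a b p q → a * b * (p * q) ≡ a * p * (b * q)
  regroup = solve-∀

-- Partial sums of the w-weighted series of (1 - x)^-(1+j); trunc keeps the terms with n ≤ j.
weightedTerm : (ℕ → ℤ) → ℕ → ℤ → ℕ → ℤ
weightedTerm w j x n = w n * + ((j ℕ.+ n) C n) * x ^ n

weightedSum : (ℕ → ℤ) → ℕ → ℕ → ℤ → ℤ
weightedSum w j m x = sumTo m (weightedTerm w j x)

trunc : (ℕ → ℤ) → ℕ → ℤ → ℤ
trunc w j = weightedSum w j (suc j)

σ θσ : ℕ → ℤ → ℤ
σ  = trunc (λ _ → + 1)
θσ = trunc (λ n → + n)

weightedTerm-pascal : ∀ w j x n →
  weightedTerm w (suc j) x (suc n) ≡ weightedTerm w j x (suc n) + x * weightedTerm (w ∘ suc) (suc j) x n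
weightedTerm-pascal w j x n = begin
  w (suc n) * + ((suc j ℕ.+ suc n) C suc n) * x ^ suc n
    ≡⟨ cong (λ c → w (suc n) * c * x ^ suc n) (trans (cong +_ (C-pascal j n)) (pos-+ p q)) ⟩
  w (suc n) * (+ p + + q) * (x * x ^ n)
    ≡⟨ distribute (w (suc n)) (+ p) (+ q) x (x ^ n) ⟩
  w (suc n) * + p * x ^ suc n + x * (w (suc n) * + q * x ^ n) ∎
  where
  p = (j ℕ.+ suc n) C suc n
  q = (suc j ℕ.+ n) C n
  distribute : ∀ w p q x e → w * (p + q) * (x * e) ≡ w * p * (x * e) + x * (w * q * e)
  distribute = solve-∀

weightedSum-pascal : ∀ w j m x →
  weightedSum w (suc j) (suc m) x ≡ weightedSum w j (suc m) x + x * weightedSum (w ∘ suc) (suc j) m x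
weightedSum-pascal w j m x = begin
  weightedSum w (suc j) (suc m) x
    ≡⟨ sumTo-sucˡ m (weightedTerm w (suc j) x) ⟩
  t₀ + sumTo m (weightedTerm w (suc j) x ∘ suc)
    ≡⟨ cong (_+_ t₀) (sumTo-cong m (weightedTerm-pascal w j x)) ⟩
  t₀ + sumTo m (λ n → a n + x * b n)
    ≡⟨ cong (_+_ t₀) (sumTo-distrib-+ m a (λ n → x * b n)) ⟩
  t₀ + (sumTo m a + sumTo m (λ n → x * b n))
    ≡⟨ cong (λ s → t₀ + (sumTo m a + s)) (*-distribˡ-sumTo m x b) ⟨
  t₀ + (sumTo m a + x * sumTo m b)
    ≡⟨ ℤₚ.+-assoc t₀ (sumTo m a) (x * sumTo m b) ⟨
  t₀ + sumTo m a + x * sumTo m b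
    ≡⟨ cong (_+ x * sumTo m b) (sumTo-sucˡ m (weightedTerm w j x)) ⟨
  weightedSum w j (suc m) x + x * weightedSum (w ∘ suc) (suc j) m x ∎
  where
  t₀ = weightedTerm w j x 0
  a = weightedTerm w j x ∘ suc
  b = weightedTerm (w ∘ suc) (suc j) x

trunc-rec : ∀ w j x → let c = + ((j ℕ.+ suc j) C suc j) in
  trunc w (suc j) x
    ≡ trunc w j x + w (suc j) * c * x ^ suc j
      + x * (trunc (w ∘ suc) (suc j) x - w (suc (suc j)) * (+ 2 * c) * x ^ suc j)
trunc-rec w j x = begin
  trunc w (suc j) x
    ≡⟨ weightedSum-pascal w j (suc j) x ⟩
  weightedSum w j (suc (suc j)) x + x * weightedSum (w ∘ suc) (suc j) (suc j) x
    ≡⟨ cong₂ (λ p q → p + x * q) (sumTo-sucʳ (suc j) (weightedTerm w j x)) below-diagonal ⟩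
  trunc w j x + w (suc j) * c * x ^ suc j + x * (trunc (w ∘ suc) (suc j) x - last) ∎
  where
  c = + ((j ℕ.+ suc j) C suc j)
  last = w (suc (suc j)) * (+ 2 * c) * x ^ suc j
  drop : ∀ s l → s ≡ s + l - l
  drop = solve-∀
  below-diagonal : weightedSum (w ∘ suc) (suc j) (suc j) x ≡ trunc (w ∘ suc) (suc j) x - last
  below-diagonal = begin
    weightedSum (w ∘ suc) (suc j) (suc j) x          ≡⟨ drop _ l ⟩
    weightedSum (w ∘ suc) (suc j) (suc j) x + l - l
      ≡⟨ cong (_- l) (sumTo-sucʳ (suc j) (weightedTerm (w ∘ suc) (suc j) x)) ⟨
    trunc (w ∘ suc) (suc j) x - l
      ≡⟨ cong (λ m → trunc (w ∘ suc) (suc j) x - w (suc (suc j)) * m * x ^ suc j)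
              (trans (cong +_ (C-central j)) (pos-* 2 ((j ℕ.+ suc j) C suc j))) ⟩
    trunc (w ∘ suc) (suc j) x - last                 ∎
    where l = weightedTerm (w ∘ suc) (suc j) x (suc j)

trunc-linear : ∀ {w} a b j x → (∀ n → w n ≡ a * + n + b) → trunc w j x ≡ a * θσ j x + b * σ j x
trunc-linear {w} a b j x w≗ = begin
  trunc w j x
    ≡⟨ sumTo-cong (suc j) split ⟩
  sumTo (suc j) (λ n → a * θterm n + b * σterm n)
    ≡⟨ sumTo-distrib-+ (suc j) (λ n → a * θterm n) (λ n → b * σterm n) ⟩
  sumTo (suc j) (λ n → a * θterm n) + sumTo (suc j) (λ n → b * σterm n)
    ≡⟨ cong₂ _+_ (*-distribˡ-sumTo (suc j) a θterm) (*-distribˡ-sumTo (suc j) b σterm) ⟨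
  a * θσ j x + b * σ j x ∎
  where
  θterm σterm : ℕ → ℤ
  θterm = weightedTerm (λ n → + n) j x
  σterm = weightedTerm (λ _ → + 1) j x
  distribute : ∀ a m b c e → (a * m + b) * c * e ≡ a * (m * c * e) + b * (+ 1 * c * e)
  distribute = solve-∀
  split : ∀ n → weightedTerm w j x n ≡ a * θterm n + b * σterm n
  split n = trans (cong (λ v → v * + ((j ℕ.+ n) C n) * x ^ n) (w≗ n))
                  (distribute a (+ n) b (+ ((j ℕ.+ n) C n)) (x ^ n))

θσ-rec : ∀ j x → let c = + ((j ℕ.+ suc j) C suc j) ; K = + suc j in
  θσ (suc j) x
    ≡ θσ j x + K * c * x ^ suc j
      + x * (θσ (suc j) x + σ (suc j) x - (+ 1 + K) * (+ 2 * c) * x ^ suc j)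
θσ-rec j x = trans (trunc-rec (λ n → + n) j x)
  (cong₂ (λ s k → θσ j x + + suc j * c * x ^ suc j + x * (s - k * (+ 2 * c) * x ^ suc j))
         shifted-weight (pos-+ 1 (suc j)))
  where
  c = + ((j ℕ.+ suc j) C suc j)
  shifted-weight : trunc (λ n → + suc n) (suc j) x ≡ θσ (suc j) x + σ (suc j) x
  shifted-weight = trans (trunc-linear (+ 1) (+ 1) (suc j) x (λ n → trans (pos-+ 1 n) (affine (+ n))))
                         (cong₂ _+_ (ℤₚ.*-identityˡ (θσ (suc j) x)) (ℤₚ.*-identityˡ (σ (suc j) x)))
    where
    affine : ∀ m → + 1 + m ≡ + 1 * m + + 1
    affine = solve-∀

trunc-binom-neg : ∀ w j x → sumTo (suc j) (λ n → (- x) ^ n * w n * binom (- + suc j) n) ≡ trunc w j x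
trunc-binom-neg w j x = sumTo-cong (suc j) term
  where
  regroup : ∀ p w s c → p * w * (s * c) ≡ w * c * (p * s)
  regroup = solve-∀
  negate-twice : ∀ x → - x * - + 1 ≡ x
  negate-twice = solve-∀
  term : ∀ n → (- x) ^ n * w n * binom (- + suc j) n ≡ weightedTerm w j x n
  term n = begin
    (- x) ^ n * w n * binom (- + suc j) n         ≡⟨ cong ((- x) ^ n * w n *_) (binom-neg j n) ⟩
    (- x) ^ n * w n * ((- + 1) ^ n * + c)         ≡⟨ regroup ((- x) ^ n) (w n) ((- + 1) ^ n) (+ c) ⟩
    w n * + c * ((- x) ^ n * (- + 1) ^ n)         ≡⟨ cong (w n * + c *_) (^-distrib-* (- x) (- + 1) n) ⟨
    w n * + c * (- x * - + 1) ^ n                 ≡⟨ cong (λ y → w n * + c * y ^ n) (negate-twice x) ⟩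
    w n * + c * x ^ n                             ∎
    where c = (j ℕ.+ n) C n

alternating-trunc : ∀ w j → sumTo (suc j) (λ n → w n * binom (- + suc j) n) ≡ trunc w j (- + 1)
alternating-trunc w j = trans (sumTo-cong (suc j) one-power) (trunc-binom-neg w j (- + 1))
  where
  one-power : ∀ n → w n * binom (- + suc j) n ≡ (+ 1) ^ n * w n * binom (- + suc j) n
  one-power n = cong (_* binom (- + suc j) n)
    (sym (trans (cong (_* w n) (ℤₚ.^-zeroˡ n)) (ℤₚ.*-identityˡ (w n))))

y≡1-x : ∀ {x y} → x + y ≡ + 1 → y ≡ + 1 - x
y≡1-x {x} {y} x+y≡1 = trans (cancel x y) (cong (_- x) x+y≡1)
  where
  cancel : ∀ x y → y ≡ x + y - x
  cancel = solve-∀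

-- With y = 1 - x substituted, the difference of the two sides is an explicit combination of the
-- differences of the hypotheses (likewise in θσ-step and lemma2p5-algebra).
σ-step : ∀ {x y a b c u v u′ v′} → x + y ≡ + 1 →
  u′ ≡ u + + 1 * c * a + x * (u′ - + 1 * (+ 2 * c) * a) →
  v′ ≡ v + + 1 * c * b + y * (v′ - + 1 * (+ 2 * c) * b) →
  b * u + a * v ≡ + 1 →
  y * b * u′ + x * a * v′ ≡ + 1
σ-step {x} {y} {a} {b} {c} {u} {v} {u′} {v′} x+y≡1 ru rv ih with y≡1-x {x} {y} x+y≡1
... | refl = x∙y⁻¹≈ε⇒x≈y _ _ (begin
  y * b * u′ + x * a * v′ - + 1
    ≡⟨ combination x a b c u v u′ v′ ⟩
  b * (u′ - Ru) + a * (v′ - Rv) + (b * u + a * v - + 1)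
    ≡⟨ cong₂ _+_ (cong₂ _+_ (cong (b *_) (x≈y⇒x∙y⁻¹≈ε ru)) (cong (a *_) (x≈y⇒x∙y⁻¹≈ε rv)))
                 (x≈y⇒x∙y⁻¹≈ε ih) ⟩
  b * + 0 + a * + 0 + + 0
    ≡⟨ vanish a b ⟩
  + 0 ∎)
  where
  Ru = u + + 1 * c * a + x * (u′ - + 1 * (+ 2 * c) * a)
  Rv = v + + 1 * c * b + y * (v′ - + 1 * (+ 2 * c) * b)
  combination : ∀ x a b c u v u′ v′ → let y = + 1 - x in
    y * b * u′ + x * a * v′ - + 1
      ≡ b * (u′ - (u + + 1 * c * a + x * (u′ - + 1 * (+ 2 * c) * a)))
        + a * (v′ - (v + + 1 * c * b + y * (v′ - + 1 * (+ 2 * c) * b)))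
        + (b * u + a * v - + 1)
  combination = solve-∀
  vanish : ∀ a b → b * + 0 + a * + 0 + + 0 ≡ + 0
  vanish = solve-∀

σ-symmetry : ∀ j {x y} → x + y ≡ + 1 → y ^ suc j * σ j x + x ^ suc j * σ j y ≡ + 1
σ-symmetry zero    {x} {y} x+y≡1 = trans (base x y) x+y≡1
  where
  base : ∀ x y → y * + 1 * + 1 + x * + 1 * + 1 ≡ x + y
  base = solve-∀
σ-symmetry (suc j) {x} {y} x+y≡1 =
  σ-step {x} {y} {x ^ suc j} {y ^ suc j} {+ ((j ℕ.+ suc j) C suc j)} x+y≡1
    (trunc-rec (λ _ → + 1) j x) (trunc-rec (λ _ → + 1) j y) (σ-symmetry j {x} {y} x+y≡1)

θσ-step : ∀ {x y a b c K u v u′ v′ s t s′ t′} → x + y ≡ + 1 →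
  u′ ≡ u + + 1 * c * (x * a) + x * (u′ - + 1 * (+ 2 * c) * (x * a)) →
  v′ ≡ v + + 1 * c * (y * b) + y * (v′ - + 1 * (+ 2 * c) * (y * b)) →
  s′ ≡ s + K * c * (x * a) + x * (s′ + u′ - (+ 1 + K) * (+ 2 * c) * (x * a)) →
  t′ ≡ t + K * c * (y * b) + y * (t′ + v′ - (+ 1 + K) * (+ 2 * c) * (y * b)) →
  y * (y * b) * s - x * (x * a) * t ≡ K * x * y * (b * u - a * v) →
  y * (y * (y * b)) * s′ - x * (x * (x * a)) * t′ ≡ (+ 1 + K) * x * y * (y * b * u′ - x * a * v′)
θσ-step {x} {y} {a} {b} {c} {K} {u} {v} {u′} {v′} {s} {t} {s′} {t′} x+y≡1 ru rv rs rt ih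
  with y≡1-x {x} {y} x+y≡1
... | refl = x∙y⁻¹≈ε⇒x≈y _ _ (begin
  y * (y * (y * b)) * s′ - x * (x * (x * a)) * t′ - (+ 1 + K) * x * y * (y * b * u′ - x * a * v′)
    ≡⟨ combination x a b c K u v u′ v′ s t s′ t′ ⟩
  y * (y * b) * (s′ - Rs) - x * (x * a) * (t′ - Rt)
    - K * x * (y * b) * (u′ - Ru) + K * y * (x * a) * (v′ - Rv)
    + (y * (y * b) * s - x * (x * a) * t - K * x * y * (b * u - a * v))
    ≡⟨ cong₂ _+_ (cong₂ _+_ (cong₂ _-_ (cong₂ _-_ (cong (y * (y * b) *_) (x≈y⇒x∙y⁻¹≈ε rs))
                                                  (cong (x * (x * a) *_) (x≈y⇒x∙y⁻¹≈ε rt)))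
                                       (cong (K * x * (y * b) *_) (x≈y⇒x∙y⁻¹≈ε ru)))
                            (cong (K * y * (x * a) *_) (x≈y⇒x∙y⁻¹≈ε rv)))
                 (x≈y⇒x∙y⁻¹≈ε ih) ⟩
  y * (y * b) * + 0 - x * (x * a) * + 0 - K * x * (y * b) * + 0 + K * y * (x * a) * + 0 + + 0
    ≡⟨ vanish x y a b K ⟩
  + 0 ∎)
  where
  Ru = u + + 1 * c * (x * a) + x * (u′ - + 1 * (+ 2 * c) * (x * a))
  Rv = v + + 1 * c * (y * b) + y * (v′ - + 1 * (+ 2 * c) * (y * b))
  Rs = s + K * c * (x * a) + x * (s′ + u′ - (+ 1 + K) * (+ 2 * c) * (x * a))
  Rt = t + K * c * (y * b) + y * (t′ + v′ - (+ 1 + K) * (+ 2 * c) * (y * b))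
  combination : ∀ x a b c K u v u′ v′ s t s′ t′ → let y = + 1 - x in
    y * (y * (y * b)) * s′ - x * (x * (x * a)) * t′ - (+ 1 + K) * x * y * (y * b * u′ - x * a * v′)
      ≡ y * (y * b) * (s′ - (s + K * c * (x * a) + x * (s′ + u′ - (+ 1 + K) * (+ 2 * c) * (x * a))))
        - x * (x * a) * (t′ - (t + K * c * (y * b) + y * (t′ + v′ - (+ 1 + K) * (+ 2 * c) * (y * b))))
        - K * x * (y * b) * (u′ - (u + + 1 * c * (x * a) + x * (u′ - + 1 * (+ 2 * c) * (x * a))))
        + K * y * (x * a) * (v′ - (v + + 1 * c * (y * b) + y * (v′ - + 1 * (+ 2 * c) * (y * b))))
        + (y * (y * b) * s - x * (x * a) * t - K * x * y * (b * u - a * v))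
  combination = solve-∀
  vanish : ∀ x y a b K →
    y * (y * b) * + 0 - x * (x * a) * + 0 - K * x * (y * b) * + 0 + K * y * (x * a) * + 0 + + 0 ≡ + 0
  vanish = solve-∀

θσ-symmetry : ∀ j {x y} → x + y ≡ + 1 →
  y ^ suc (suc j) * θσ j x - x ^ suc (suc j) * θσ j y ≡ + suc j * x * y * (y ^ j * σ j x - x ^ j * σ j y)
θσ-symmetry zero    {x} {y} _     = base x y
  where
  base : ∀ x y → y * (y * + 1) * + 0 - x * (x * + 1) * + 0 ≡ + 1 * x * y * (+ 1 * + 1 - + 1 * + 1)
  base = solve-∀
θσ-symmetry (suc j) {x} {y} x+y≡1 =
  trans (θσ-step {x} {y} {x ^ j} {y ^ j} {c} {+ suc j} x+y≡1
           (trunc-rec (λ _ → + 1) j x) (trunc-rec (λ _ → + 1) j y) (θσ-rec j x) (θσ-rec j y)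
           (θσ-symmetry j {x} {y} x+y≡1))
        (cong (λ k → k * x * y * (y ^ suc j * σ (suc j) x - x ^ suc j * σ (suc j) y)) (sym (pos-+ 1 (suc j))))
  where c = + ((j ℕ.+ suc j) C suc j)

-- Here Q, P, R, E stand for (-1)ʲ, 2ʲ, (-1)ʲ⁺² and (-2)ʲ.
lemma2p5-algebra : ∀ {K Q P R E A B A′ B′} →
  Q * Q ≡ + 1 → R ≡ - + 1 * Q * - + 1 → E ≡ Q * P →
  - + 1 * Q * A + + 2 * P * B ≡ + 1 →
  - + 1 * (- + 1 * Q) * A′ - + 2 * (+ 2 * P) * B′ ≡ K * + 2 * - + 1 * (Q * A - P * B) →
  + 1 * A′ + (+ 1 - K) * A ≡ R * (+ 3 * K - + 1) - - + 2 * E * (+ 2 * B′ + (+ 1 - + 2 * K) * B)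
lemma2p5-algebra {K} {Q} {P} {A = A} {B} {A′} {B′} QQ≡1 refl refl h₀ h₁ = x∙y⁻¹≈ε⇒x≈y _ _ (begin
  + 1 * A′ + (+ 1 - K) * A
    - (- + 1 * Q * - + 1 * (+ 3 * K - + 1) - - + 2 * (Q * P) * (+ 2 * B′ + (+ 1 - + 2 * K) * B))
    ≡⟨ combination K Q P A B A′ B′ ⟩
  Q * d₁ - (+ 1 - + 3 * K) * Q * d₀ - (A′ + (+ 1 - K) * A) * (Q * Q - + 1)
    ≡⟨ cong₂ _-_ (cong₂ _-_ (cong (Q *_) (x≈y⇒x∙y⁻¹≈ε h₁))
                            (cong ((+ 1 - + 3 * K) * Q *_) (x≈y⇒x∙y⁻¹≈ε h₀)))
                 (cong ((A′ + (+ 1 - K) * A) *_) (x≈y⇒x∙y⁻¹≈ε QQ≡1)) ⟩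
  Q * + 0 - (+ 1 - + 3 * K) * Q * + 0 - (A′ + (+ 1 - K) * A) * + 0
    ≡⟨ vanish K Q A A′ ⟩
  + 0 ∎)
  where
  d₀ = - + 1 * Q * A + + 2 * P * B - + 1
  d₁ = - + 1 * (- + 1 * Q) * A′ - + 2 * (+ 2 * P) * B′ - K * + 2 * - + 1 * (Q * A - P * B)
  combination : ∀ K Q P A B A′ B′ →
    + 1 * A′ + (+ 1 - K) * A
      - (- + 1 * Q * - + 1 * (+ 3 * K - + 1) - - + 2 * (Q * P) * (+ 2 * B′ + (+ 1 - + 2 * K) * B))
    ≡ Q * (- + 1 * (- + 1 * Q) * A′ - + 2 * (+ 2 * P) * B′ - K * + 2 * - + 1 * (Q * A - P * B))
      - (+ 1 - + 3 * K) * Q * (- + 1 * Q * A + + 2 * P * B - + 1)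
      - (A′ + (+ 1 - K) * A) * (Q * Q - + 1)
  combination = solve-∀
  vanish : ∀ K Q A A′ → Q * + 0 - (+ 1 - + 3 * K) * Q * + 0 - (A′ + (+ 1 - K) * A) * + 0 ≡ + 0
  vanish = solve-∀

lemma2p5-lhs : ∀ j → let K = + suc j in
  sumTo (suc j) (λ n → (- + 2) ^ n * (+ n - K + + 1) * binom (- K) n)
    ≡ + 1 * θσ j (+ 2) + (+ 1 - K) * σ j (+ 2)
lemma2p5-lhs j = trans (trunc-binom-neg (λ n → + n - + suc j + + 1) j (+ 2))
                       (trunc-linear (+ 1) (+ 1 - + suc j) j (+ 2) (λ n → weight (+ n) (+ suc j)))
  where
  weight : ∀ n K → n - K + + 1 ≡ + 1 * n + (+ 1 - K)
  weight = solve-∀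

lemma2p5-rhs : ∀ j → let K = + suc j in
  sumTo (suc j) (λ n → (+ 2 * + n - + 2 * K + + 1) * binom (- K) n)
    ≡ + 2 * θσ j (- + 1) + (+ 1 - + 2 * K) * σ j (- + 1)
lemma2p5-rhs j = trans (alternating-trunc (λ n → + 2 * + n - + 2 * + suc j + + 1) j)
                       (trunc-linear (+ 2) (+ 1 - + 2 * + suc j) j (- + 1) (λ n → weight (+ n) (+ suc j)))
  where
  weight : ∀ n K → + 2 * n - + 2 * K + + 1 ≡ + 2 * n + (+ 1 - + 2 * K)
  weight = solve-∀

lemma2p5 : (k : ℕ) → 1 ≤ k →
    sumTo k (λ n → (- + 2) ^ n * (+ n - + k + + 1) * binom (- + k) n)
    ≡ (- + 1) ^ (Data.Nat._+_ k 1) * (+ 3 * + k - + 1)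
    - (- + 2) ^ k * sumTo k (λ n → (+ 2 * + n - + 2 * + k + + 1) * binom (- + k) n)
lemma2p5 zero    ()
lemma2p5 (suc j) _ = begin
  sumTo (suc j) (λ n → (- + 2) ^ n * (+ n - K + + 1) * binom (- K) n)
    ≡⟨ lemma2p5-lhs j ⟩
  + 1 * θσ j (+ 2) + (+ 1 - K) * σ j (+ 2)
    ≡⟨ lemma2p5-algebra {K} {(- + 1) ^ j} {(+ 2) ^ j} {A = σ j (+ 2)} {σ j (- + 1)} {θσ j (+ 2)} {θσ j (- + 1)}
         (trans (sym (^-distrib-* (- + 1) (- + 1) j)) (ℤₚ.^-zeroˡ j))
         (ℤₚ.^-distribˡ-+-* (- + 1) (suc j) 1)
         (^-distrib-* (- + 1) (+ 2) j)
         (σ-symmetry j {x = + 2} {y = - + 1} refl)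
         (θσ-symmetry j {x = + 2} {y = - + 1} refl) ⟩
  (- + 1) ^ (suc j ℕ.+ 1) * (+ 3 * K - + 1)
    - (- + 2) ^ suc j * (+ 2 * θσ j (- + 1) + (+ 1 - + 2 * K) * σ j (- + 1))
    ≡⟨ cong (λ s → (- + 1) ^ (suc j ℕ.+ 1) * (+ 3 * K - + 1) - (- + 2) ^ suc j * s) (lemma2p5-rhs j) ⟨
  (- + 1) ^ (suc j ℕ.+ 1) * (+ 3 * K - + 1)
    - (- + 2) ^ suc j * sumTo (suc j) (λ n → (+ 2 * + n - + 2 * K + + 1) * binom (- K) n) ∎
  where K = + suc j
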